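{- Let $q$ be a prime and let $S_1,S_2,T_1(n),T_2(n),B,C$ be as in the context. Let $N>1$ be an integer with $\omega(N)\ge B$ and $p_1(N)\ge C$. Then there exists an integer $n$ with $0\le n\le N-1$ such that $\gcd(N,t_1)=1$ for all $t_1\in T_1(n)$ and $\gcd(N,t_2)>1$ for all $t_2\in T_2(n)$.
   Context: Let $A=\lceil q^2/2\rceil$ and $A'=\big\lceil q(Aq+q-1)/\sqrt{q^2-1}\big\rceil$. Let $S_1=\{(Aq+j,q): 1\le j\le q-1\}$ and $S_2=\{(a,b)\in\mathbb{Z}^2: 0\le b\le a,\ \gcd(a,b)=1,\ a\le A'\}\setminus S_1$. For an integer $n$ and $i=1,2$ let $T_i(n)=\{an+b: (a,b)\in S_i\}$. Let $B=|S_2|$, $C'=\max\{|a_2b_1-a_1b_2|: (a_1,b_1)\in S_1,\ (a_2,b_2)\in S_2\}$ and $C=\max\{C',A'\}+1$. $\omega(N)$ is the number of distinct prime factors of $N$ and $p_1(N)$ its smallest prime factor. -}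

module Defs where

open import Data.Bool using (Bool; true; false; if_then_else_; _∧_; not)
open import Data.Nat using (ℕ; zero; suc; _+_; _*_; _∸_; _^_; _≤ᵇ_; _≡ᵇ_; _⊔_; ∣_-_∣; _/_)
open import Data.Nat.GCD using (gcd)
open import Data.Nat.Divisibility using (_∣?_)
open import Data.Nat.Primality using (prime?)
open import Data.List using (List; []; _∷_; map; concatMap; upTo; filter; filterᵇ; length; foldr)
open import Data.Product using (_×_; _,_)
open import Relation.Nullary using (does)
open import Relation.Nullary.Decidable using (_×-dec_)

search : (ℕ → Bool) → ℕ → ℕ → ℕ
search P zero    x = x
search P (suc f) x = if P x then x else search P f (suc x)

-- A = ⌈q²/2⌉
Aq : ℕ → ℕ
Aq q = (q ^ 2 + 1) / 2

Kq : ℕ → ℕ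
Kq q = Aq q * q + q ∸ 1

-- A' = ⌈ q K / √(q²-1) ⌉ = the least natural x with x ≥ qK/√(q²-1),
-- i.e. the least x with (qK)² ≤ x² (q²-1)  (both sides nonnegative).
-- x = qK always satisfies this when q ≥ 2, so the search bound suffices.
A′ : ℕ → ℕ
A′ q = search (λ x → ((q * Kq q) ^ 2) ≤ᵇ (x ^ 2 * (q ^ 2 ∸ 1))) (suc (q * Kq q)) 0

S₁ : ℕ → List (ℕ × ℕ)
S₁ q = map (λ j → (Aq q * q + suc j , q)) (upTo (q ∸ 1))

inS₁ : ℕ → ℕ → ℕ → Bool
inS₁ q a b = (b ≡ᵇ q) ∧ ((Aq q * q + 1) ≤ᵇ a) ∧ (a ≤ᵇ (Aq q * q + (q ∸ 1)))

-- S₂ = {(a,b) ∈ ℤ² : 0 ≤ b ≤ a, gcd(a,b) = 1, a ≤ A'} \ S₁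
-- (0 ≤ b ≤ a forces a,b ≥ 0, so enumerating naturals is exhaustive)
S₂ : ℕ → List (ℕ × ℕ)
S₂ q = filterᵇ (λ { (a , b) → (gcd a b ≡ᵇ 1) ∧ not (inS₁ q a b) })
         (concatMap (λ a → map (λ b → (a , b)) (upTo (suc a))) (upTo (suc (A′ q))))

Bq : ℕ → ℕ
Bq q = length (S₂ q)

C′ : ℕ → ℕ
C′ q = foldr _⊔_ 0
  (concatMap (λ { (a₁ , b₁) → map (λ { (a₂ , b₂) → ∣ a₂ * b₁ - a₁ * b₂ ∣ }) (S₂ q) }) (S₁ q))

Cq : ℕ → ℕ
Cq q = (C′ q ⊔ A′ q) + 1

-- ω(N): number of distinct primes p dividing N (all such p satisfy p ≤ N for N ≥ 1)
ω : ℕ → ℕ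
ω N = length (filter (λ p → prime? p ×-dec (p ∣? N)) (upTo (suc N)))

-- p₁(N): smallest prime factor = smallest d ≥ 2 with d ∣ N (for N > 1; found within d ≤ N)
p₁ : ℕ → ℕ
p₁ N = search (λ d → does (d ∣? N)) N 2

-- Enumerate the prime divisors of N and pair them with the elements of S₂, which is possible
-- because ω(N) ≥ |S₂|; primes left over are paired with (1 , 0) ∈ S₂. Every coefficient a of S₂
-- satisfies 0 < a ≤ A′ < p₁(N), so by the Chinese remainder theorem there is n with p ∣ a n + b
-- for every assigned pair p ↦ (a , b). This settles T₂(n). If a prime r ∣ N divided a₁ n + b₁
-- with (a₁ , b₁) ∈ S₁, it would also divide a₂ n + b₂ for the pair (a₂ , b₂) ∈ S₂ assigned to r,
-- hence divide a₂ b₁ − a₁ b₂. That determinant is nonzero (two coprime pairs with zero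
-- determinant coincide, and S₁ ∩ S₂ = ∅) and at most C′ < r, a contradiction.
module Submission where

open import Defs
open import Data.Bool using (Bool; true; false; T; T?; _∧_; not)
open import Data.Bool.Properties using (T-∧; T-≡; T-not-≡)
open import Data.Empty using (⊥)
open import Data.List using (List; []; _∷_; map; concatMap; length; filter; upTo; foldr)
open import Data.List.Membership.Propositional using (_∈_; find; lose)
open import Data.List.Membership.Propositional.Properties
  using (∈-map⁺; ∈-map⁻; ∈-filter⁺; ∈-filter⁻; ∈-upTo⁺; ∈-upTo⁻; ∈-concatMap⁺; ∈-concatMap⁻)
open import Data.List.Relation.Unary.All as All using (All; []; _∷_)
open import Data.List.Relation.Unary.All.Properties using (map⁺)
open import Data.List.Relation.Unary.AllPairs using ([]; _∷_)
open import Data.List.Relation.Unary.Any using (here; there)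
open import Data.List.Relation.Unary.Unique.Propositional using (Unique)
open import Data.List.Relation.Unary.Unique.Propositional.Properties using (upTo⁺)
import Data.List.Relation.Unary.Unique.Propositional.Properties as Unique
open import Data.Nat
open import Data.Nat.Properties
open import Data.Nat.Coprimality
  using (Coprime; coprime-Bézout; coprime-divisor; coprime⇒gcd≡1; gcd≡1⇒coprime; prime⇒coprime)
import Data.Nat.Coprimality as Coprime
open import Data.Nat.Divisibility
open import Data.Nat.DivMod using (_%_; _/_; m≡m%n+[m/n]*n; m%n<n)
open import Data.Nat.GCD using (gcd; module Bézout; gcd-greatest; gcd[m,n]≢0; gcd-identityˡ)
open import Data.Nat.ListAction using (product)
open import Data.Nat.ListAction.Properties using (∈⇒∣product)
open import Data.Nat.Primality
open import Data.Nat.Primality.Factorisation using (factorise; factorisationHasAllPrimeFactors)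
open import Data.Nat.Tactic.RingSolver using (solve-∀)
open import Data.Product using (_×_; _,_; proj₁; proj₂; ∃-syntax)
open import Data.Sum using (_⊎_; inj₁; inj₂)
open import Function using (_∘_; _⇔_; mk⇔; Equivalence)
open import Relation.Nullary using (¬_; does; contradiction)
open import Relation.Nullary.Decidable using (_×-dec_; dec-true)
open import Relation.Binary.PropositionalEquality

private
  variable
    a b c d m n p q r M N : ℕ

-- Primes and coprimality

prime⇒>1 : Prime p → 1 < p
prime⇒>1 {p} p-prime = nonTrivial⇒n>1 p {{prime⇒nonTrivial p-prime}}

prime∤⇒coprime : Prime p → ¬ p ∣ n → Coprime p n
prime∤⇒coprime p-prime p∤n (d∣p , d∣n) with prime⇒irreducible p-prime d∣p
... | inj₁ d≡1 = d≡1
... | inj₂ refl = contradiction d∣n p∤n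

∃-prime-divisor : 1 < n → ∃[ p ] Prime p × p ∣ n
∃-prime-divisor {n} 1<n with factorise n {{>-nonZero (<⇒≤ 1<n)}}
... | record { factors = [] ; isFactorisation = n≡1 } = contradiction n≡1 (>⇒≢ 1<n)
... | record { factors = p ∷ ps ; isFactorisation = n≡Π ; factorsPrime = p-prime ∷ _ } =
  p , p-prime , subst (p ∣_) (sym n≡Π) (m∣m*n (product ps))

no-common-prime⇒coprime : .{{NonZero m}} → (∀ {p} → Prime p → p ∣ m → ¬ p ∣ n) → Coprime m n
no-common-prime⇒coprime {m} no-p {zero} (0∣m , _) = contradiction (0∣⇒≡0 0∣m) (≢-nonZero⁻¹ m)
no-common-prime⇒coprime no-p {1} _ = refl
no-common-prime⇒coprime no-p {2+ i} (i∣m , i∣n)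
  with p , p-prime , p∣i ← ∃-prime-divisor {2+ i} (s≤s (s≤s z≤n)) =
  contradiction (∣-trans p∣i i∣n) (no-p p-prime (∣-trans p∣i i∣m))

∤*product : Prime p → ¬ p ∣ c → {qs : List ℕ} → All Prime qs → All (p ≢_) qs →
            ¬ p ∣ c * product qs
∤*product {c = c} p-prime p∤c qs-prime p≢qs p∣cΠ with euclidsLemma c _ p-prime p∣cΠ
... | inj₁ p∣c = p∤c p∣c
... | inj₂ p∣Π = All.lookup p≢qs (factorisationHasAllPrimeFactors p-prime p∣Π qs-prime) refl

coprime-cross-product⇒≡ : Coprime c d → Coprime a b → .{{NonZero b}} →
                          c * b ≡ a * d → c ≡ a × d ≡ b
coprime-cross-product⇒≡ {c} {d} {a} {b} c⊥d a⊥b cb≡ad = c≡a , d≡b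
  where
  d∣b : d ∣ b
  d∣b = coprime-divisor (Coprime.sym c⊥d) (subst (d ∣_) (sym cb≡ad) (n∣m*n a))
  b∣d : b ∣ d
  b∣d = coprime-divisor (Coprime.sym a⊥b) (subst (b ∣_) cb≡ad (n∣m*n c))
  d≡b : d ≡ b
  d≡b = ∣-antisym d∣b b∣d
  c≡a : c ≡ a
  c≡a = *-cancelʳ-≡ c a b (trans cb≡ad (cong (a *_) d≡b))

∣m∣n⇒∣m∸n : d ∣ m → d ∣ n → d ∣ m ∸ n
∣m∣n⇒∣m∸n {d} {m} {n} d∣m d∣n with ≤-total n m
... | inj₁ n≤m = ∣m+n∣m⇒∣n (subst (d ∣_) (sym (m+[n∸m]≡n n≤m)) d∣m) d∣n
... | inj₂ m≤n = subst (d ∣_) (sym (m≤n⇒m∸n≡0 m≤n)) (d ∣0)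

∣m∣n⇒∣∣m-n∣ : d ∣ m → d ∣ n → d ∣ ∣ m - n ∣
∣m∣n⇒∣∣m-n∣ {d} {m} {n} d∣m d∣n with ∣m-n∣≡[m∸n]∨[n∸m] m n
... | inj₁ ∣m-n∣≡m∸n = subst (d ∣_) (sym ∣m-n∣≡m∸n) (∣m∣n⇒∣m∸n d∣m d∣n)
... | inj₂ ∣m-n∣≡n∸m = subst (d ∣_) (sym ∣m-n∣≡n∸m) (∣m∣n⇒∣m∸n d∣n d∣m)

∣-determinant : ∀ a₁ b₁ a₂ b₂ n → r ∣ a₁ * n + b₁ → r ∣ a₂ * n + b₂ → r ∣ ∣ a₂ * b₁ - a₁ * b₂ ∣
∣-determinant {r} a₁ b₁ a₂ b₂ n r∣t₁ r∣t₂ =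
  subst (r ∣_) cancel (∣m∣n⇒∣∣m-n∣ (∣n⇒∣m*n a₂ r∣t₁) (∣n⇒∣m*n a₁ r∣t₂))
  where
  open ≡-Reasoning
  expand : ∀ x y z → x * (y * n + z) ≡ x * y * n + x * z
  expand x y z = trans (*-distribˡ-+ x (y * n) z) (cong (_+ x * z) (sym (*-assoc x y n)))
  cancel : ∣ a₂ * (a₁ * n + b₁) - a₁ * (a₂ * n + b₂) ∣ ≡ ∣ a₂ * b₁ - a₁ * b₂ ∣
  cancel = begin
    ∣ a₂ * (a₁ * n + b₁) - a₁ * (a₂ * n + b₂) ∣
      ≡⟨ cong₂ ∣_-_∣ (expand a₂ a₁ b₁) (expand a₁ a₂ b₂) ⟩
    ∣ a₂ * a₁ * n + a₂ * b₁ - a₁ * a₂ * n + a₁ * b₂ ∣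
      ≡⟨ cong (λ x → ∣ x * n + a₂ * b₁ - a₁ * a₂ * n + a₁ * b₂ ∣) (*-comm a₂ a₁) ⟩
    ∣ a₁ * a₂ * n + a₂ * b₁ - a₁ * a₂ * n + a₁ * b₂ ∣
      ≡⟨ ∣m+n-m+o∣≡∣n-o∣ (a₁ * a₂ * n) (a₂ * b₁) (a₁ * b₂) ⟩
    ∣ a₂ * b₁ - a₁ * b₂ ∣ ∎

-- Linear congruences and the Chinese remainder theorem

coprime⇒∃-negated-inverse : .{{NonZero m}} → Coprime m a → ∃[ u ] m ∣ a * u + 1
coprime⇒∃-negated-inverse {m} {a} m⊥a with coprime-Bézout m⊥a
... | Bézout.+- x y 1+ya≡xm =
  y , divides x (trans (+-comm (a * y) 1) (trans (cong (1 +_) (*-comm a y)) 1+ya≡xm))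
... | Bézout.-+ x y 1+xm≡ya with suc m′ ← m = y * m′ , divides (1 + x * m′) (begin
  a * (y * m′) + 1           ≡⟨ cong (_+ 1) (trans (sym (*-assoc a y m′))
                                                  (cong (_* m′) (*-comm a y))) ⟩
  y * a * m′ + 1             ≡⟨ cong (λ t → t * m′ + 1) (sym 1+xm≡ya) ⟩
  (1 + x * suc m′) * m′ + 1  ≡⟨ regroup x m′ ⟩
  (1 + x * m′) * suc m′      ∎)
  where
  open ≡-Reasoning
  regroup : ∀ x m′ → (1 + x * suc m′) * m′ + 1 ≡ (1 + x * m′) * suc m′
  regroup = solve-∀

coprime⇒linear-solvable : .{{NonZero m}} → Coprime m a → ∀ b → ∃[ k ] m ∣ a * k + b
coprime⇒linear-solvable {m} {a} m⊥a b with u , m∣au+1 ← coprime⇒∃-negated-inverse m⊥a =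
  u * b , subst (m ∣_) (begin
    (a * u + 1) * b    ≡⟨ *-distribʳ-+ b (a * u) 1 ⟩
    a * u * b + 1 * b  ≡⟨ cong₂ _+_ (*-assoc a u b) (*-identityˡ b) ⟩
    a * (u * b) + b    ∎) (∣m⇒∣m*n b m∣au+1)
  where open ≡-Reasoning

Congruence : Set
Congruence = ℕ × ℕ × ℕ

_Solves_ : ℕ → Congruence → Set
n Solves (p , c , d) = p ∣ c * n + d

Admissible : Congruence → Set
Admissible (p , c , _) = Prime p × ¬ p ∣ c

linear-shift : ∀ c n k M d → c * (n + k * M) + d ≡ c * M * k + (c * n + d)
linear-shift = solve-∀

solves-shift : ∀ t k → proj₁ t ∣ M → n Solves t ⇔ (n + k * M) Solves t
solves-shift {M} {n} (p , c , d) k p∣M = mk⇔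
  (λ h → subst (p ∣_) (sym (linear-shift c n k M d)) (∣m∣n⇒∣m+n p∣cMk h))
  (λ h → ∣m+n∣m⇒∣n (subst (p ∣_) (linear-shift c n k M d) h) p∣cMk)
  where
  p∣cMk : p ∣ c * M * k
  p∣cMk = ∣m⇒∣m*n k (∣n⇒∣m*n c p∣M)

crt-distinct-primes : (cs : List Congruence) → All Admissible cs → Unique (map proj₁ cs) →
                      ∃[ n ] All (n Solves_) cs
crt-distinct-primes [] [] [] = 0 , []
crt-distinct-primes ((p , c , d) ∷ cs) ((p-prime , p∤c) ∷ admissible) (p∉cs ∷ unique)
  with n₀ , n₀-solves ← crt-distinct-primes cs admissible unique
  with k , p∣head ← coprime⇒linear-solvable {{prime⇒nonZero p-prime}}
    (prime∤⇒coprime p-prime (∤*product p-prime p∤c (map⁺ (All.map proj₁ admissible)) p∉cs))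
    (c * n₀ + d) =
  n₀ + k * Π
    , subst (p ∣_) (sym (linear-shift c n₀ k Π d)) p∣head
    ∷ All.tabulate (λ {t} t∈cs →
        Equivalence.to (solves-shift t k (∈⇒∣product (∈-map⁺ proj₁ t∈cs)))
                       (All.lookup n₀-solves t∈cs))
  where
  Π : ℕ
  Π = product (map proj₁ cs)

-- Assigning a pair of S to every prime divisor of N

zipPadded : {A B : Set} → B → List A → List B → List (A × B)
zipPadded y₀ []       _        = []
zipPadded y₀ (x ∷ xs) []       = (x , y₀) ∷ zipPadded y₀ xs []
zipPadded y₀ (x ∷ xs) (y ∷ ys) = (x , y) ∷ zipPadded y₀ xs ys

map-proj₁-zipPadded : {A B : Set} (y₀ : B) (xs : List A) (ys : List B) →
                      map proj₁ (zipPadded y₀ xs ys) ≡ xs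
map-proj₁-zipPadded y₀ []       _        = refl
map-proj₁-zipPadded y₀ (x ∷ xs) []       = cong (x ∷_) (map-proj₁-zipPadded y₀ xs [])
map-proj₁-zipPadded y₀ (x ∷ xs) (y ∷ ys) = cong (x ∷_) (map-proj₁-zipPadded y₀ xs ys)

∈-zipPadded⁻ˡ : {A B : Set} {y₀ : B} {xs : List A} {ys : List B} {x : A} {y : B} →
                (x , y) ∈ zipPadded y₀ xs ys → x ∈ xs
∈-zipPadded⁻ˡ {y₀ = y₀} {xs} {ys} x,y∈ =
  subst (_ ∈_) (map-proj₁-zipPadded y₀ xs ys) (∈-map⁺ proj₁ x,y∈)

∈-zipPadded⁻ʳ : {A B : Set} {y₀ : B} (xs : List A) (ys : List B) {x : A} {y : B} →
                (x , y) ∈ zipPadded y₀ xs ys → y ≡ y₀ ⊎ y ∈ ys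
∈-zipPadded⁻ʳ (_ ∷ _)  []       (here refl)  = inj₁ refl
∈-zipPadded⁻ʳ (_ ∷ xs) []       (there x,y∈) = ∈-zipPadded⁻ʳ xs [] x,y∈
∈-zipPadded⁻ʳ (_ ∷ _)  (_ ∷ _)  (here refl)  = inj₂ (here refl)
∈-zipPadded⁻ʳ (_ ∷ xs) (_ ∷ ys) (there x,y∈) with ∈-zipPadded⁻ʳ xs ys x,y∈
... | inj₁ y≡y₀ = inj₁ y≡y₀
... | inj₂ y∈ys = inj₂ (there y∈ys)

∈-zipPadded⁺ʳ : {A B : Set} {y₀ : B} (xs : List A) {ys : List B} {y : B} →
                length ys ≤ length xs → y ∈ ys → ∃[ x ] (x , y) ∈ zipPadded y₀ xs ys
∈-zipPadded⁺ʳ (x ∷ _)  _         (here refl) = x , here refl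
∈-zipPadded⁺ʳ (_ ∷ xs) (s≤s len) (there y∈ys) with x , x,y∈ ← ∈-zipPadded⁺ʳ xs len y∈ys =
  x , there x,y∈

-- ω N is length (primeDivisors N) by definition.
primeDivisors : ℕ → List ℕ
primeDivisors N = filter (λ p → prime? p ×-dec (p ∣? N)) (upTo (suc N))

∈-primeDivisors⁻ : p ∈ primeDivisors N → Prime p × p ∣ N
∈-primeDivisors⁻ {N = N} p∈ =
  proj₂ (∈-filter⁻ (λ p → prime? p ×-dec (p ∣? N)) {xs = upTo (suc N)} p∈)

∈-primeDivisors⁺ : .{{NonZero N}} → Prime p → p ∣ N → p ∈ primeDivisors N
∈-primeDivisors⁺ {N} p-prime p∣N =
  ∈-filter⁺ (λ p → prime? p ×-dec (p ∣? N)) (∈-upTo⁺ (s≤s (∣⇒≤ p∣N))) (p-prime , p∣N)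

primeDivisors-unique : ∀ N → Unique (primeDivisors N)
primeDivisors-unique N = Unique.filter⁺ (λ p → prime? p ×-dec (p ∣? N)) (upTo⁺ (suc N))

-- pad is the pair assigned to the prime divisors left over once S is exhausted.
covering-residue :
  ∀ N .{{_ : NonZero N}} (S : List (ℕ × ℕ)) {pad : ℕ × ℕ} → pad ∈ S → length S ≤ ω N →
  (∀ {c d p} → (c , d) ∈ S → Prime p → p ∣ N → ¬ p ∣ c) →
  ∃[ n ] n < N
    × (∀ {c d} → (c , d) ∈ S → ∃[ p ] Prime p × p ∣ N × p ∣ c * n + d)
    × (∀ {p} → Prime p → p ∣ N → ∃[ c ] ∃[ d ] (c , d) ∈ S × p ∣ c * n + d)
covering-residue N S {pad} pad∈S |S|≤ω p∤c = residue , m%n<n n₀ N , hit-by-prime , prime-hits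
  where
  cs : List Congruence
  cs = zipPadded pad (primeDivisors N) S
  assigned∈S : ∀ {p c d} → (p , c , d) ∈ cs → (c , d) ∈ S
  assigned∈S p,c,d∈ with ∈-zipPadded⁻ʳ (primeDivisors N) S p,c,d∈
  ... | inj₁ refl = pad∈S
  ... | inj₂ c,d∈S = c,d∈S
  admissible : All Admissible cs
  admissible = All.tabulate λ p,c,d∈ →
    let p-prime , p∣N = ∈-primeDivisors⁻ (∈-zipPadded⁻ˡ p,c,d∈)
    in p-prime , p∤c (assigned∈S p,c,d∈) p-prime p∣N
  unique : Unique (map proj₁ cs)
  unique = subst Unique (sym (map-proj₁-zipPadded pad (primeDivisors N) S))
                 (primeDivisors-unique N)
  solution : ∃[ n ] All (n Solves_) cs
  solution = crt-distinct-primes cs admissible unique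
  n₀ residue : ℕ
  n₀ = proj₁ solution
  residue = n₀ % N
  residue-solves : ∀ {t} → t ∈ cs → residue Solves t
  residue-solves {t} t∈cs = Equivalence.from
    (solves-shift t (n₀ / N) (proj₂ (∈-primeDivisors⁻ (∈-zipPadded⁻ˡ t∈cs))))
    (subst (_Solves t) (m≡m%n+[m/n]*n n₀ N) (All.lookup (proj₂ solution) t∈cs))
  hit-by-prime : ∀ {c d} → (c , d) ∈ S → ∃[ p ] Prime p × p ∣ N × p ∣ c * residue + d
  hit-by-prime c,d∈S with p , p,c,d∈ ← ∈-zipPadded⁺ʳ (primeDivisors N) |S|≤ω c,d∈S =
    let p-prime , p∣N = ∈-primeDivisors⁻ (∈-zipPadded⁻ˡ p,c,d∈)
    in p , p-prime , p∣N , residue-solves p,c,d∈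
  prime-hits : ∀ {p} → Prime p → p ∣ N → ∃[ c ] ∃[ d ] (c , d) ∈ S × p ∣ c * residue + d
  prime-hits p-prime p∣N
    with (_ , c , d) , p∈ , refl ← ∈-map⁻ proj₁ (subst (_ ∈_)
           (sym (map-proj₁-zipPadded pad (primeDivisors N) S)) (∈-primeDivisors⁺ p-prime p∣N)) =
    c , d , assigned∈S p∈ , residue-solves p∈

-- The sets S₁ and S₂ and the constants A′, C′, C

search-≥ : ∀ P f x → x ≤ search P f x
search-≥ P zero    x = ≤-refl
search-≥ P (suc f) x with P x
... | true  = ≤-refl
... | false = ≤-trans (n≤1+n x) (search-≥ P f (suc x))

search-skip : ∀ P f x → P x ≡ false → suc x ≤ search P (suc f) x
search-skip P f x Px≡false rewrite Px≡false = search-≥ P f (suc x)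

search-≤ : ∀ P f {x y} → x ≤ y → y < x + f → T (P y) → search P f x ≤ y
search-≤ P zero    {x} x≤y y<x+0 _ = contradiction (subst (_ <_) (+-identityʳ x) y<x+0) (≤⇒≯ x≤y)
search-≤ P (suc f) {x} {y} x≤y y<x+f Py with P x in Px | m≤n⇒m<n∨m≡n x≤y
... | true  | _        = x≤y
... | false | inj₂ refl = contradiction (subst T Px Py) λ ()
... | false | inj₁ x<y  = search-≤ P f x<y (subst (y <_) (+-suc x f) y<x+f) Py

p₁-minimal : .{{NonZero N}} → Prime p → p ∣ N → p₁ N ≤ p
p₁-minimal {N} {p} p-prime p∣N = search-≤ (λ d → does (d ∣? N)) N (prime⇒>1 p-prime)
  (s≤s (≤-trans (∣⇒≤ p∣N) (n≤1+n N))) (Equivalence.from T-≡ (dec-true (p ∣? N) p∣N))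

Kq-positive : Prime q → 0 < Kq q
Kq-positive {q} q-prime =
  ≤-trans (∸-monoˡ-≤ 1 (prime⇒>1 q-prime)) (∸-monoˡ-≤ 1 (m≤n+m q (Aq q * q)))

A′-positive : Prime q → 0 < A′ q
-- The search defining A′ rejects x = 0 because (q K)² > 0 = 0² (q² − 1).
A′-positive {q} q-prime = search-skip _ (q * Kq q) 0 (square≰ᵇ0 (q * Kq q) qK-positive)
  where
  square≰ᵇ0 : ∀ x → 0 < x → (x ^ 2 ≤ᵇ 0) ≡ false
  square≰ᵇ0 (suc x) _ = refl
  qK-positive : 0 < q * Kq q
  qK-positive = >-nonZero⁻¹ (q * Kq q)
    {{m*n≢0 q (Kq q) {{prime⇒nonZero q-prime}} {{>-nonZero (Kq-positive q-prime)}}}}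

∈-S₁⁻ : (a , b) ∈ S₁ q → ∃[ j ] j < q ∸ 1 × a ≡ Aq q * q + suc j × b ≡ q
∈-S₁⁻ a,b∈ with j , j∈ , refl ← ∈-map⁻ _ a,b∈ = j , ∈-upTo⁻ j∈ , refl , refl

∈-S₁⇒inS₁ : (a , b) ∈ S₁ q → T (inS₁ q a b)
∈-S₁⇒inS₁ {q = q} a,b∈ with j , j<q-1 , refl , refl ← ∈-S₁⁻ a,b∈ =
  Equivalence.from T-∧ (≡⇒≡ᵇ q q refl , Equivalence.from T-∧
    (≤⇒≤ᵇ (+-monoʳ-≤ (Aq q * q) (s≤s z≤n)) , ≤⇒≤ᵇ (+-monoʳ-≤ (Aq q * q) j<q-1)))

∈-S₁⇒coprime : Prime q → (a , b) ∈ S₁ q → Coprime a b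
∈-S₁⇒coprime {q} q-prime a,b∈ (i∣a , i∣q) with j , j<q-1 , refl , refl ← ∈-S₁⁻ a,b∈ =
  prime⇒coprime q-prime
    (≤-trans (s≤s j<q-1) (≤-reflexive (suc-pred q {{prime⇒nonZero q-prime}})))
    (i∣q , ∣m+n∣m⇒∣n i∣a (∣n⇒∣m*n (Aq q) i∣q))

S₂-selects : ℕ → ℕ × ℕ → Bool
S₂-selects q (a , b) = (gcd a b ≡ᵇ 1) ∧ not (inS₁ q a b)

row : ℕ → List (ℕ × ℕ)
row a = map (a ,_) (upTo (suc a))

∈-S₂⁻ : ∀ q → (a , b) ∈ S₂ q → gcd a b ≡ 1 × b ≤ a × a ≤ A′ q × inS₁ q a b ≡ false
∈-S₂⁻ {a} {b} q a,b∈
  with a,b∈pairs , selected ←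
         ∈-filter⁻ (T? ∘ S₂-selects q) {xs = concatMap row (upTo (suc (A′ q)))} a,b∈
  with a′ , a′∈ , a,b∈row ← find (∈-concatMap⁻ row {xs = upTo (suc (A′ q))} a,b∈pairs)
  with b′ , b′∈ , refl ← ∈-map⁻ (a′ ,_) a,b∈row =
  let gcd≡1 , not-inS₁ = Equivalence.to T-∧ selected
  in ≡ᵇ⇒≡ (gcd a b) 1 gcd≡1 , ≤-pred (∈-upTo⁻ b′∈) , ≤-pred (∈-upTo⁻ a′∈)
     , Equivalence.to T-not-≡ not-inS₁

∈-S₂⇒0<a : ∀ q → (a , b) ∈ S₂ q → 0 < a
∈-S₂⇒0<a {zero} {b} q a,b∈ with gcd≡1 , b≤0 , _ ← ∈-S₂⁻ q a,b∈ =
  contradiction (subst (_≤ 0) (trans (sym (gcd-identityˡ b)) gcd≡1) b≤0) λ ()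
∈-S₂⇒0<a {suc a} _ _ = z<s

[1,0]∈S₂ : Prime q → (1 , 0) ∈ S₂ q
[1,0]∈S₂ {zero}   0-prime = contradiction 0-prime ¬prime[0]
[1,0]∈S₂ {suc q′} q-prime =
  ∈-filter⁺ (T? ∘ S₂-selects (suc q′))
    (∈-concatMap⁺ row (lose (∈-upTo⁺ (s≤s (A′-positive q-prime))) (here refl))) _

S₁-S₂-disjoint : (a , b) ∈ S₁ q → (a , b) ∈ S₂ q → ⊥
S₁-S₂-disjoint a,b∈S₁ a,b∈S₂ with _ , _ , _ , not-inS₁ ← ∈-S₂⁻ _ a,b∈S₂ =
  subst T not-inS₁ (∈-S₁⇒inS₁ a,b∈S₁)

∈⇒≤foldr-⊔ : ∀ {x} xs → x ∈ xs → x ≤ foldr _⊔_ 0 xs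
∈⇒≤foldr-⊔ (y ∷ xs) (here refl) = m≤m⊔n y _
∈⇒≤foldr-⊔ (y ∷ xs) (there x∈) = ≤-trans (∈⇒≤foldr-⊔ xs x∈) (m≤n⊔m y _)

determinant≤C′ : (a , b) ∈ S₁ q → (c , d) ∈ S₂ q → ∣ c * b - a * d ∣ ≤ C′ q
determinant≤C′ a,b∈ c,d∈ = ∈⇒≤foldr-⊔ _ (∈-concatMap⁺ _ (lose a,b∈ (∈-map⁺ _ c,d∈)))

C′<Cq : ∀ q → C′ q < Cq q
C′<Cq q = ≤-<-trans (m≤m⊔n (C′ q) (A′ q)) (m<m+n _ z<s)

A′<Cq : ∀ q → A′ q < Cq q
A′<Cq q = ≤-<-trans (m≤n⊔m (C′ q) (A′ q)) (m<m+n _ z<s)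

Cq≤prime-divisor : ∀ q → .{{NonZero N}} → Cq q ≤ p₁ N → Prime p → p ∣ N → Cq q ≤ p
Cq≤prime-divisor q Cq≤p₁ p-prime p∣N = ≤-trans Cq≤p₁ (p₁-minimal p-prime p∣N)

S₂-coefficient-∤ : ∀ q → .{{NonZero N}} → Cq q ≤ p₁ N →
                   (c , d) ∈ S₂ q → Prime p → p ∣ N → ¬ p ∣ c
S₂-coefficient-∤ q Cq≤p₁ c,d∈ p-prime p∣N p∣c with _ , _ , c≤A′ , _ ← ∈-S₂⁻ q c,d∈ =
  <⇒≱ (≤-<-trans c≤A′ (<-≤-trans (A′<Cq q) (Cq≤prime-divisor q Cq≤p₁ p-prime p∣N)))
      (∣⇒≤ {{>-nonZero (∈-S₂⇒0<a q c,d∈)}} p∣c)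

determinant-nonzero : Prime q → (a , b) ∈ S₁ q → (c , d) ∈ S₂ q → ∣ c * b - a * d ∣ ≢ 0
determinant-nonzero {q} {a} {b} {c} {d} q-prime a,b∈ c,d∈ det≡0
  with _ , _ , _ , b≡q ← ∈-S₁⁻ a,b∈
  with gcd≡1 , _ ← ∈-S₂⁻ q c,d∈
  with c≡a , d≡b ← coprime-cross-product⇒≡ (gcd≡1⇒coprime gcd≡1) (∈-S₁⇒coprime q-prime a,b∈)
                     {{subst NonZero (sym b≡q) (prime⇒nonZero q-prime)}} (∣m-n∣≡0⇒m≡n det≡0) =
  S₁-S₂-disjoint a,b∈ (subst₂ (λ x y → (x , y) ∈ S₂ q) c≡a d≡b c,d∈)

common-prime⇒1<gcd : .{{NonZero m}} → ∃[ p ] Prime p × p ∣ m × p ∣ n → 1 < gcd m n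
common-prime⇒1<gcd {m} {n} (p , p-prime , p∣m , p∣n) =
  ≤-trans (prime⇒>1 p-prime)
    (∣⇒≤ {{≢-nonZero (gcd[m,n]≢0 m n (inj₁ (≢-nonZero⁻¹ m)))}} (gcd-greatest p∣m p∣n))

S₁-values-coprime : ∀ q → .{{NonZero N}} → Prime q → Cq q ≤ p₁ N →
                    (∀ {r} → Prime r → r ∣ N → ∃[ c ] ∃[ d ] (c , d) ∈ S₂ q × r ∣ c * n + d) →
                    (a , b) ∈ S₁ q → gcd N (a * n + b) ≡ 1
S₁-values-coprime {n = n} {a = a} {b = b} q q-prime Cq≤p₁ prime-hit a,b∈ =
  coprime⇒gcd≡1 (no-common-prime⇒coprime λ r-prime r∣N r∣an+b →
    let c , d , c,d∈ , r∣cn+d = prime-hit r-prime r∣N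
    in <⇒≱ (≤-<-trans (determinant≤C′ a,b∈ c,d∈)
                      (<-≤-trans (C′<Cq q) (Cq≤prime-divisor q Cq≤p₁ r-prime r∣N)))
           (∣⇒≤ {{≢-nonZero (determinant-nonzero q-prime a,b∈ c,d∈)}}
                (∣-determinant a b c d n r∣an+b r∣cn+d)))

lemma7p3 : (q : ℕ) → Prime q → (N : ℕ) → 1 < N → Bq q ≤ ω N → Cq q ≤ p₁ N →
           ∃[ n ] (n < N
             × (∀ a b → (a , b) ∈ S₁ q → gcd N (a * n + b) ≡ 1)
             × (∀ a b → (a , b) ∈ S₂ q → 1 < gcd N (a * n + b)))
lemma7p3 q q-prime N@(suc _) _ |S₂|≤ω Cq≤p₁ =
  let n , n<N , S₂-hit , prime-hit =
        covering-residue N (S₂ q) ([1,0]∈S₂ q-prime) |S₂|≤ω (S₂-coefficient-∤ q Cq≤p₁)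
  in n , n<N , (λ _ _ → S₁-values-coprime q q-prime Cq≤p₁ prime-hit)
             , (λ _ _ → common-prime⇒1<gcd ∘ S₂-hit)
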